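{- Let $G$ be a graph with no $K_{1,1,3}$ minor and no $K_1 \cup K_{2,3}$ minor, and let $S$ be a spanning subgraph of $G$ that is a subdivision of $K_{2,3}$ with terminal paths $P_1,P_2,P_3$, where $P_2$ is a middle path among $\{P_1,P_2,P_3\}$. Suppose $G[P_1 \cup P_2]$ and $G[P_2 \cup P_3]$ are subgraphs of fan graphs $G_1^+$ and $G_2^+$, respectively, having the same handle $h$. Then $P_2$ has length $2$.
   Context: A subdivision of a graph is obtained by repeatedly replacing an edge by a path of length 2 through a new vertex. For a subdivision $S$ of $K_{2,3}$, the terminal vertices are the two vertices $u,v$ of degree $3$ in $S$ and the terminal paths are the three $uv$-paths of $S$; $S$ is spanning if it contains all vertices of $G$. The length of a path is its number of edges. $G[H]$ is the subgraph of $G$ induced by the vertices of $H$. An inner vertex of a $uv$-path is a vertex other than $u,v$. Given a set $\mathcal{P}$ of paths in $G$, $P\in\mathcal{P}$ is a middle path if for every other $P'\in\mathcal{P}$ some edge of $G$ joins an inner vertex of $P$ to an inner vertex of $P'$. A fan graph is obtained from a path $Q$ and a vertex $h\notin Q$ by adding an edge from $h$ to every vertex of $Q$; $h$ is the handle. $\cup$ in $K_1\cup K_{2,3}$ denotes disjoint union. -}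

module Defs where

open import Data.Nat using (ℕ; zero; suc; _≤_)
open import Data.Fin using (Fin; zero; suc)
open import Data.Bool using (Bool; true; false; T)
open import Data.List using (List; []; _∷_; _++_; _∷ʳ_; length)
open import Data.List.Membership.Propositional using (_∈_; _∉_)
open import Data.List.Relation.Unary.All using (All)
open import Data.List.Relation.Unary.Linked using (Linked)
open import Data.List.Relation.Unary.Unique.Propositional using (Unique)
open import Data.Product using (Σ; ∃; ∃-syntax; _×_; _,_)
open import Data.Sum using (_⊎_)
open import Relation.Binary.PropositionalEquality using (_≡_; _≢_)
open import Relation.Nullary using (¬_)

record Graph : Set₁ where
  field
    n     : ℕ
    Adj   : Fin n → Fin n → Set
    sym   : ∀ {x y} → Adj x y → Adj y x
    irrefl : ∀ {x} → ¬ Adj x x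

open Graph public

V : Graph → Set
V G = Fin (n G)

fromBool : (k : ℕ) (a : Fin k → Fin k → Bool) →
           (∀ {x y} → T (a x y) → T (a y x)) →
           (∀ {x} → ¬ T (a x x)) → Graph
fromBool k a s i = record { n = k ; Adj = λ x y → T (a x y) ; sym = s ; irrefl = i }

-- K_{1,1,3}: vertices 0,1 adjacent to each other and to 2,3,4;
-- 2,3,4 pairwise non-adjacent.

k113 : Fin 5 → Fin 5 → Bool
k113 zero zero = false
k113 zero _ = true
k113 (suc zero) zero = true
k113 (suc zero) (suc zero) = false
k113 (suc zero) _ = true
k113 (suc (suc _)) zero = true
k113 (suc (suc _)) (suc zero) = true
k113 (suc (suc _)) (suc (suc _)) = false

k113-sym : ∀ {x y} → T (k113 x y) → T (k113 y x)
k113-sym {zero} {zero} ()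
k113-sym {zero} {suc zero} t = t
k113-sym {zero} {suc (suc y)} t = t
k113-sym {suc zero} {zero} t = t
k113-sym {suc zero} {suc zero} ()
k113-sym {suc zero} {suc (suc y)} t = t
k113-sym {suc (suc x)} {zero} t = t
k113-sym {suc (suc x)} {suc zero} t = t
k113-sym {suc (suc x)} {suc (suc y)} ()

k113-irr : ∀ {x} → ¬ T (k113 x x)
k113-irr {zero} ()
k113-irr {suc zero} ()
k113-irr {suc (suc x)} ()

K113 : Graph
K113 = fromBool 5 k113 k113-sym k113-irr

-- K_1 ∪ K_{2,3}: vertices 0,1 adjacent to each of 2,3,4 (and nothing
-- else); vertex 5 isolated.

isSmall : Fin 6 → Bool
isSmall zero = true
isSmall (suc zero) = true
isSmall _ = false

isBig : Fin 6 → Bool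
isBig (suc (suc zero)) = true
isBig (suc (suc (suc zero))) = true
isBig (suc (suc (suc (suc zero)))) = true
isBig _ = false

k123 : Fin 6 → Fin 6 → Bool
k123 x y with isSmall x | isBig x | isSmall y | isBig y
... | true | _ | _ | true = true
... | _ | true | true | _ = true
... | _ | _ | _ | _ = false

k123-sym : ∀ {x y} → T (k123 x y) → T (k123 y x)
k123-sym {x} {y} t with isSmall x | isBig x | isSmall y | isBig y
k123-sym t | true | true | true | true = t
k123-sym t | true | false | true | true = t
k123-sym t | false | true | true | true = t
k123-sym t | false | false | true | true = t
k123-sym t | true | true | false | true = t
k123-sym t | true | false | false | true = t
k123-sym t | true | true | true | false = t
k123-sym t | false | true | true | false = t
k123-sym () | true | false | true | false
k123-sym () | false | false | true | false
k123-sym () | true | false | false | false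
k123-sym () | false | true | false | true
k123-sym () | false | false | false | true
k123-sym () | true | true | false | false
k123-sym () | false | true | false | false
k123-sym () | false | false | false | false

k123-irr : ∀ {x} → ¬ T (k123 x x)
k123-irr {zero} ()
k123-irr {suc zero} ()
k123-irr {suc (suc zero)} ()
k123-irr {suc (suc (suc zero))} ()
k123-irr {suc (suc (suc (suc zero)))} ()
k123-irr {suc (suc (suc (suc (suc zero))))} ()

K1∪K23 : Graph
K1∪K23 = fromBool 6 k123 k123-sym k123-irr

record IsWalk (G : Graph) (x y : V G) (P : List (V G)) : Set where
  field
    linked : Linked (Adj G) P
    start  : ∃[ ys ] P ≡ x ∷ ys
    end    : ∃[ zs ] P ≡ zs ∷ʳ y

record IsPath (G : Graph) (x y : V G) (P : List (V G)) : Set where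
  field
    walk   : IsWalk G x y P
    unique : Unique P

-- the length of a path is its number of edges: a path with k vertices
-- has length k - 1, so "length 2" means 3 vertices.

Inner : {A : Set} → A → A → List A → A → Set
Inner u v P x = x ∈ P × x ≢ u × x ≢ v

record MinorModel (H G : Graph) : Set₁ where
  field
    branch    : V H → V G → Set
    nonempty  : ∀ a → ∃[ x ] branch a x
    disjoint  : ∀ a b x → branch a x → branch b x → a ≡ b
    connected : ∀ a x y → branch a x → branch a y →
                ∃[ W ] (IsWalk G x y W × All (branch a) W)
    edges     : ∀ a b → Adj H a b →
                ∃[ x ] ∃[ y ] (branch a x × branch b y × Adj G x y)

IsMinor : Graph → Graph → Set₁
IsMinor H G = MinorModel H G

record SpanningK23 (G : Graph) (u v : V G) (P₁ P₂ P₃ : List (V G)) : Set where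
  field
    u≢v      : u ≢ v
    path₁    : IsPath G u v P₁
    path₂    : IsPath G u v P₂
    path₃    : IsPath G u v P₃
    -- each terminal path subdivides a path of length 2 of K_{2,3}
    long₁    : 3 ≤ length P₁
    long₂    : 3 ≤ length P₂
    long₃    : 3 ≤ length P₃
    disj₁₂   : ∀ x → Inner u v P₁ x → ¬ Inner u v P₂ x
    disj₁₃   : ∀ x → Inner u v P₁ x → ¬ Inner u v P₃ x
    disj₂₃   : ∀ x → Inner u v P₂ x → ¬ Inner u v P₃ x
    spanning : ∀ (x : V G) → x ∈ P₁ ⊎ x ∈ P₂ ⊎ x ∈ P₃

-- P is a middle path with respect to P' (within paths with ends u, v):
-- some edge joins an inner vertex of P to an inner vertex of P'
EdgeBetweenInner : (G : Graph) (u v : V G) (P P' : List (V G)) → Set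
EdgeBetweenInner G u v P P' =
  ∃[ x ] ∃[ y ] (Inner u v P x × Inner u v P' y × Adj G x y)

Consecutive : {A : Set} → List A → A → A → Set
Consecutive {A} Q x y = ∃[ as ] ∃[ bs ] Q ≡ as ++ (x ∷ y ∷ bs)

FanEdge : {A : Set} → A → List A → A → A → Set
FanEdge h Q x y = (x ≡ h × y ∈ Q) ⊎ (y ≡ h × x ∈ Q) ⊎ Consecutive Q x y ⊎ Consecutive Q y x

-- The induced subgraph G[X] is a subgraph of a fan graph with handle h
-- (fan vertices taken among the vertices of G).
InFanWithHandle : (G : Graph) (X : V G → Set) (h : V G) → Set
InFanWithHandle G X h =
  ∃[ Q ] ( Q ≢ []
         × Unique Q
         × h ∉ Q
         × (∀ x → X x → x ≡ h ⊎ x ∈ Q)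
         × (∀ x y → X x → X y → Adj G x y → FanEdge h Q x y))

-- If an edge xy joins inner vertices of two terminal paths and x, y ≢ h, split both paths at x
-- and y. The handle misses either both segments from u or both segments to v; these segments lie
-- in the fan minus its handle, that is in its path Q, and leave their common end in opposite
-- directions along Q, so x and y lie on different sides of that end and are not adjacent.
-- Applied to the edges from P₂ to P₁ and to P₃, this makes h an inner vertex of P₂ with
-- neighbours inside P₁ and P₃. Further inner vertices of P₂ between u and h would give a
-- K₁ ∪ K₂,₃ minor with branch sets {u}, {h}, those vertices, the interiors of P₁ and P₃, and {v};
-- symmetrically between h and v.

module Submission where

open import Defs hiding (sym)
open import Data.Fin using (Fin; zero; suc; _≟_)
open import Data.List using (List; []; _∷_; _++_; [_]; _∷ʳ_; _ʳ++_; reverse; length; tabulate)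
open import Data.List.Properties using (++-assoc; reverse-++; unfold-reverse; ∷-injectiveˡ; ∷-injectiveʳ)
open import Data.List.Membership.Propositional using (_∈_; _∉_)
open import Data.List.Membership.Propositional.Properties using (∈-++⁺ˡ; ∈-++⁺ʳ; ∈-++⁻; ∈-∃++)
open import Data.List.Relation.Unary.Any as Any using (here; there)
import Data.List.Relation.Unary.Any.Properties as Any
open import Data.List.Relation.Unary.All as All using (All; []; _∷_; lookup)
import Data.List.Relation.Unary.All.Properties as All
open import Data.List.Relation.Unary.AllPairs using (AllPairs; []; _∷_)
open import Data.List.Relation.Unary.Linked as Linked using (Linked; []; [-]; _∷_)
open import Data.List.Relation.Unary.Linked.Properties using (Linked⇒All)
open import Data.List.Relation.Unary.Unique.Propositional using (Unique)
open import Data.List.Relation.Binary.Disjoint.Propositional using (Disjoint)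
import Data.List.Relation.Binary.Disjoint.Propositional.Properties as Disjoint
open import Data.List.Relation.Binary.Subset.Propositional using (_⊆_)
import Data.List.Relation.Binary.Subset.Propositional.Properties as Subset
open import Data.Nat using (ℕ; suc; _+_; _<_; _≤_; s≤s⁻¹)
open import Data.Nat.Properties using (suc-injective; +-suc; <-trans; <-asym; ≤-reflexive; ≤⇒≯)
open import Data.Product using (∃-syntax; _×_; _,_; proj₁; proj₂; uncurry)
open import Data.Sum using (_⊎_; inj₁; inj₂; swap)
open import Data.Empty using (⊥-elim)
open import Data.Bool using (T)
open import Function using (flip; _∘_)
open import Relation.Binary using (Symmetric; DecidableEquality)
open import Relation.Binary.Construct.Closure.ReflexiveTransitive as Star using (Star; ε; _◅_; _◅◅_)
open import Relation.Nullary using (¬_; yes; no; contradiction)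
open import Relation.Binary.PropositionalEquality
  using (_≡_; _≢_; refl; sym; trans; cong; subst; subst₂; ≢-sym; module ≡-Reasoning)

pattern 0F = zero
pattern 1F = suc 0F
pattern 2F = suc 1F
pattern 3F = suc 2F
pattern 4F = suc 3F
pattern 5F = suc 4F

module _ {A : Set} where

  module _ {R : A → A → Set} where

    linked-++⁻ˡ : ∀ xs {ys} → Linked R (xs ++ ys) → Linked R xs
    linked-++⁻ˡ []           _        = []
    linked-++⁻ˡ (x ∷ [])     _        = [-]
    linked-++⁻ˡ (x ∷ y ∷ xs) (r ∷ rs) = r ∷ linked-++⁻ˡ (y ∷ xs) rs

    linked-first : ∀ {x xs y} → y ∈ xs → Linked R (x ∷ xs) → ∃[ z ] (z ∈ xs × R x z)
    linked-first {xs = z ∷ _} _ (r ∷ _) = z , here refl , r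

    linked-last : ∀ xs {x y ys} → x ∈ xs → Linked R (xs ++ y ∷ ys) → ∃[ z ] (z ∈ xs × R z y)
    linked-last (z ∷ [])     _ (r ∷ _)  = z , here refl , r
    linked-last (_ ∷ z ∷ xs) _ (_ ∷ rs) with linked-last (z ∷ xs) (here refl) rs
    ... | z′ , z′∈ , r = z′ , there z′∈ , r

    linked-ʳ++ : Symmetric R → ∀ {x} xs {ys} → Linked R (x ∷ xs) → Linked R (x ∷ ys) →
                 Linked R (xs ʳ++ x ∷ ys)
    linked-ʳ++ R-sym []       _        rs = rs
    linked-ʳ++ R-sym (_ ∷ xs) (r ∷ rs) ss = linked-ʳ++ R-sym xs rs (R-sym r ∷ ss)

    linked-reverse : Symmetric R → ∀ {xs} → Linked R xs → Linked R (reverse xs)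
    linked-reverse R-sym {[]}     _  = []
    linked-reverse R-sym {_ ∷ xs} rs = linked-ʳ++ R-sym xs rs [-]

  unique-++⁻ˡ : ∀ xs {ys : List A} → Unique (xs ++ ys) → Unique xs
  unique-++⁻ˡ []       _       = []
  unique-++⁻ˡ (x ∷ xs) (p ∷ u) = All.++⁻ˡ xs p ∷ unique-++⁻ˡ xs u

  unique-++⁻ʳ : ∀ xs {ys : List A} → Unique (xs ++ ys) → Unique ys
  unique-++⁻ʳ []       u       = u
  unique-++⁻ʳ (x ∷ xs) (_ ∷ u) = unique-++⁻ʳ xs u

  unique-++⇒disjoint : ∀ xs {ys : List A} → Unique (xs ++ ys) → Disjoint xs ys
  unique-++⇒disjoint (x ∷ xs) (p ∷ _) (here refl , x∈) = lookup (All.++⁻ʳ xs p) x∈ refl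
  unique-++⇒disjoint (x ∷ xs) (_ ∷ u) (there z∈ , z∈′) = unique-++⇒disjoint xs u (z∈ , z∈′)

  unique-ʳ++ : ∀ xs {ys : List A} → Unique xs → Unique ys → Disjoint xs ys → Unique (xs ʳ++ ys)
  unique-ʳ++ []       _        u xs#ys = u
  unique-ʳ++ (x ∷ xs) (p ∷ u′) u xs#ys =
    unique-ʳ++ xs u′ (All.tabulate (λ y∈ x≡y → xs#ys (here refl , subst (_∈ _) (sym x≡y) y∈)) ∷ u)
      λ { (z∈ , here refl) → lookup p z∈ refl
        ; (z∈ , there z∈′) → xs#ys (there z∈ , z∈′) }

  unique-reverse : ∀ {xs : List A} → Unique xs → Unique (reverse xs)
  unique-reverse {xs} u = unique-ʳ++ xs u [] (λ ())

  reverse-at : ∀ xs (x : A) ys → reverse (xs ++ x ∷ ys) ≡ reverse ys ++ x ∷ reverse xs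
  reverse-at xs x ys = begin
    reverse (xs ++ x ∷ ys)           ≡⟨ reverse-++ xs (x ∷ ys) ⟩
    reverse (x ∷ ys) ++ reverse xs   ≡⟨ cong (_++ reverse xs) (unfold-reverse x ys) ⟩
    (reverse ys ∷ʳ x) ++ reverse xs  ≡⟨ ++-assoc (reverse ys) [ x ] (reverse xs) ⟩
    reverse ys ++ x ∷ reverse xs     ∎
    where open ≡-Reasoning

  ∈-∉⇒≢ : ∀ {x y : A} {L} → x ∈ L → y ∉ L → x ≢ y
  ∈-∉⇒≢ x∈ y∉ refl = y∉ x∈

  ∉⇒disjoint : ∀ {x : A} {M} → x ∉ M → Disjoint [ x ] M
  ∉⇒disjoint x∉ (here refl , x∈) = x∉ x∈

  ≢⇒disjoint : ∀ {x y : A} → x ≢ y → Disjoint [ x ] [ y ]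
  ≢⇒disjoint x≢y (here refl , here x≡y) = x≢y x≡y

  disjoint-family : ∀ {k} {B : Fin k → List A} {a b x} →
                    AllPairs Disjoint (tabulate B) → x ∈ B a → x ∈ B b → a ≡ b
  disjoint-family {a = zero}  {zero}  _        _  _  = refl
  disjoint-family {a = zero}  {suc b} (d ∷ _)  p  q  = ⊥-elim (All.tabulate⁻ d b (p , q))
  disjoint-family {a = suc a} {zero}  (d ∷ _)  p  q  = ⊥-elim (All.tabulate⁻ d a (q , p))
  disjoint-family {a = suc a} {suc b} (_ ∷ ds) p  q  = cong suc (disjoint-family ds p q)

module PathPositions {A : Set} (_≟_ : DecidableEquality A) (Q : List A) (Q-unique : Unique Q) where

  index : List A → A → ℕ
  index []       a = 0
  index (b ∷ bs) a with a ≟ b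
  ... | yes _ = 0
  ... | no  _ = suc (index bs a)

  index-head : ∀ a bs → index (a ∷ bs) a ≡ 0
  index-head a bs with a ≟ a
  ... | yes _   = refl
  ... | no  a≢a = contradiction refl a≢a

  index-next : ∀ {a b} bs → b ≢ a → index (a ∷ b ∷ bs) b ≡ 1
  index-next {a} {b} bs b≢a with b ≟ a
  ... | yes b≡a = contradiction b≡a b≢a
  ... | no  _   = cong suc (index-head b bs)

  index-++ : ∀ xs {ys a} → a ∉ xs → index (xs ++ ys) a ≡ length xs + index ys a
  index-++ []                 _   = refl
  index-++ (x ∷ xs) {a = a} a∉ with a ≟ x
  ... | yes a≡x = contradiction (here a≡x) a∉
  ... | no  _   = cong suc (index-++ xs (a∉ ∘ there))

  index-injective : ∀ {xs a b} → a ∈ xs → b ∈ xs → index xs a ≡ index xs b → a ≡ b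
  index-injective {x ∷ xs} {a} {b} a∈ b∈ eq with a ≟ x | b ≟ x
  ... | yes a≡x | yes b≡x = trans a≡x (sym b≡x)
  ... | no  a≢x | no  b≢x = index-injective (Any.tail a≢x a∈) (Any.tail b≢x b∈) (suc-injective eq)

  index-consecutive : ∀ as {a b bs} → Unique (as ++ a ∷ b ∷ bs) →
                      index (as ++ a ∷ b ∷ bs) b ≡ suc (index (as ++ a ∷ b ∷ bs) a)
  index-consecutive as {a} {b} {bs} u = begin
    index (as ++ a ∷ b ∷ bs) b              ≡⟨ index-++ as (λ b∈ → outside (b∈ , there (here refl))) ⟩
    length as + index (a ∷ b ∷ bs) b        ≡⟨ cong (length as +_) (index-next bs b≢a) ⟩
    length as + 1                           ≡⟨ +-suc (length as) 0 ⟩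
    suc (length as + 0)                     ≡⟨ cong (λ i → suc (length as + i)) (index-head a (b ∷ bs)) ⟨
    suc (length as + index (a ∷ b ∷ bs) a)  ≡⟨ cong suc (index-++ as (λ a∈ → outside (a∈ , here refl))) ⟨
    suc (index (as ++ a ∷ b ∷ bs) a)        ∎
    where
      open ≡-Reasoning
      outside : Disjoint as (a ∷ b ∷ bs)
      outside = unique-++⇒disjoint as u
      b≢a : b ≢ a
      b≢a with unique-++⁻ʳ as u
      ... | a∉ ∷ _ = lookup a∉ (here refl) ∘ sym

  pos : A → ℕ
  pos = index Q

  Neighbours : A → A → Set
  Neighbours a b = Consecutive Q a b ⊎ Consecutive Q b a

  Ascends : A → A → Set
  Ascends a b = pos b ≡ suc (pos a)

  neighbours-sym : ∀ {a b} → Neighbours a b → Neighbours b a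
  neighbours-sym = swap

  consecutive-∈ : ∀ {a b} → Consecutive Q a b → a ∈ Q × b ∈ Q
  consecutive-∈ (as , bs , Q≡) = subst (_ ∈_) (sym Q≡) (∈-++⁺ʳ as (here refl))
                               , subst (_ ∈_) (sym Q≡) (∈-++⁺ʳ as (there (here refl)))

  neighbours-∈ˡ : ∀ {a b} → Neighbours a b → a ∈ Q
  neighbours-∈ˡ (inj₁ c) = proj₁ (consecutive-∈ c)
  neighbours-∈ˡ (inj₂ c) = proj₂ (consecutive-∈ c)

  neighbours-∈ʳ : ∀ {a b} → Neighbours a b → b ∈ Q
  neighbours-∈ʳ = neighbours-∈ˡ ∘ neighbours-sym

  consecutive⇒ascends : ∀ {a b} → Consecutive Q a b → Ascends a b
  consecutive⇒ascends {a} {b} (as , bs , Q≡) =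
    subst (λ L → index L b ≡ suc (index L a)) (sym Q≡) (index-consecutive as (subst Unique Q≡ Q-unique))

  neighbours⇒step : ∀ {a b} → Neighbours a b → Ascends a b ⊎ Ascends b a
  neighbours⇒step (inj₁ c) = inj₁ (consecutive⇒ascends c)
  neighbours⇒step (inj₂ c) = inj₂ (consecutive⇒ascends c)

  -- Without a repeated vertex, a walk along Q cannot turn back.
  ray-direction : ∀ {e as} → Linked Neighbours (e ∷ as) → Unique (e ∷ as) →
                  Linked Ascends (e ∷ as) ⊎ Linked (flip Ascends) (e ∷ as)
  ray-direction [-] _ = inj₁ [-]
  ray-direction (n ∷ [-]) _ with neighbours⇒step n
  ... | inj₁ up   = inj₁ (up ∷ [-])
  ... | inj₂ down = inj₂ (down ∷ [-])
  ray-direction (n ∷ ns@(n′ ∷ _)) (e∉ ∷ u) with neighbours⇒step n | ray-direction ns u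
  ... | inj₁ up   | inj₁ ups        = inj₁ (up ∷ ups)
  ... | inj₂ down | inj₂ downs      = inj₂ (down ∷ downs)
  ... | inj₁ up   | inj₂ (down ∷ _) =
    contradiction (revisit (suc-injective (trans (sym up) down))) (lookup e∉ (there (here refl)))
    where revisit = index-injective (neighbours-∈ˡ n) (neighbours-∈ʳ n′)
  ... | inj₂ down | inj₁ (up ∷ _)   =
    contradiction (revisit (trans down (sym up))) (lookup e∉ (there (here refl)))
    where revisit = index-injective (neighbours-∈ˡ n) (neighbours-∈ʳ n′)

  ascending-above : ∀ {e as} → Linked Ascends (e ∷ as) → All (λ z → pos e < pos z) as
  ascending-above [-]         = []
  ascending-above (up ∷ ups) =
    Linked⇒All <-trans (≤-reflexive (sym up)) (Linked.map (λ up′ → ≤-reflexive (sym up′)) ups)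

  descending-below : ∀ {e as} → Linked (flip Ascends) (e ∷ as) → All (λ z → pos z < pos e) as
  descending-below [-]             = []
  descending-below (down ∷ downs) =
    Linked⇒All (flip <-trans) (≤-reflexive (sym down)) (Linked.map (λ down′ → ≤-reflexive (sym down′)) downs)

  no-neighbours-across : ∀ {e x y} → pos e < pos x → pos y < pos e → ¬ Neighbours x y
  no-neighbours-across e<x y<e n with neighbours⇒step n
  ... | inj₁ up   = <-asym (<-trans y<e e<x) (≤-reflexive (sym up))
  ... | inj₂ down = ≤⇒≯ (s≤s⁻¹ (subst (_ ≤_) down e<x)) y<e

  -- Two walks along Q leaving e through distinct vertices run in opposite directions.
  rays-apart : ∀ {e as bs x y} →
               Linked Neighbours (e ∷ as) → Unique (e ∷ as) →
               Linked Neighbours (e ∷ bs) → Unique (e ∷ bs) →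
               Disjoint as bs → x ∈ as → y ∈ bs → ¬ Neighbours x y
  rays-apart {as = _ ∷ _} {_ ∷ _} (n ∷ ns) us (m ∷ ms) vs as#bs x∈ y∈
    with ray-direction (n ∷ ns) us | ray-direction (m ∷ ms) vs
  ... | inj₁ (up ∷ _)   | inj₁ (up′ ∷ _)   =
    ⊥-elim (as#bs (here refl , here (same-step (trans up (sym up′)))))
    where same-step = index-injective (neighbours-∈ʳ n) (neighbours-∈ʳ m)
  ... | inj₂ (down ∷ _) | inj₂ (down′ ∷ _) =
    ⊥-elim (as#bs (here refl , here (same-step (suc-injective (trans (sym down) down′)))))
    where same-step = index-injective (neighbours-∈ʳ n) (neighbours-∈ʳ m)
  ... | inj₁ ups        | inj₂ downs       =
    no-neighbours-across (lookup (ascending-above ups) x∈) (lookup (descending-below downs) y∈)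
  ... | inj₂ downs      | inj₁ ups         =
    no-neighbours-across (lookup (ascending-above ups) y∈) (lookup (descending-below downs) x∈) ∘ neighbours-sym

module _ (G : Graph) where
  open import Data.List.Membership.DecPropositional (_≟_ {n G}) using (_∈?_)

  private
    Vertex = V G

  route : Vertex → List Vertex → Vertex → List Vertex
  route u I v = u ∷ I ++ [ v ]

  Touch : List Vertex → List Vertex → Set
  Touch L L′ = ∃[ x ] ∃[ y ] (x ∈ L × y ∈ L′ × Adj G x y)

  record Path (u v : Vertex) (I : List Vertex) : Set where
    field
      linked : Linked (Adj G) (route u I v)
      unique : Unique (route u I v)

  record Theta (u v : Vertex) (I₁ I₂ I₃ : List Vertex) : Set where
    field
      path₁ : Path u v I₁
      path₂ : Path u v I₂
      path₃ : Path u v I₃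
      disjoint₁₂ : Disjoint I₁ I₂
      disjoint₁₃ : Disjoint I₁ I₃
      disjoint₂₃ : Disjoint I₂ I₃

  module _ {u v I} (P : Path u v I) where
    open Path P

    start∉ : u ∉ I
    start∉ u∈ with unique
    ... | u∉ ∷ _ = lookup u∉ (∈-++⁺ˡ u∈) refl

    end∉ : v ∉ I
    end∉ v∈ with unique
    ... | _ ∷ u′ = unique-++⇒disjoint I u′ (v∈ , here refl)

    start≢end : u ≢ v
    start≢end u≡v with unique
    ... | u∉ ∷ _ = lookup u∉ (∈-++⁺ʳ I (here refl)) u≡v

    ∈⇒inner : ∀ {z} → z ∈ I → Inner u v (route u I v) z
    ∈⇒inner z∈ = there (∈-++⁺ˡ z∈) , ∈-∉⇒≢ z∈ start∉ , ∈-∉⇒≢ z∈ end∉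

    interior-linked : Linked (Adj G) I
    interior-linked = linked-++⁻ˡ I (Linked.tail linked)

    first-step : ∀ {y} → y ∈ I → Touch [ u ] I
    first-step y∈ = let m , m∈ , um = linked-first y∈ (linked-++⁻ˡ (u ∷ I) linked) in u , m , here refl , m∈ , um

  inner⇒∈ : ∀ {u v I z} → Inner u v (route u I v) z → z ∈ I
  inner⇒∈ (here z≡u , z≢u , _) = contradiction z≡u z≢u
  inner⇒∈ {I = I} (there z∈ , _ , z≢v) with ∈-++⁻ I z∈
  ... | inj₁ z∈I        = z∈I
  ... | inj₂ (here z≡v) = contradiction z≡v z≢v

  inner-edge⇒touch : ∀ {u v I I′} → EdgeBetweenInner G u v (route u I v) (route u I′ v) → Touch I I′
  inner-edge⇒touch (x , y , x-in , y-in , xy) = x , y , inner⇒∈ x-in , inner⇒∈ y-in , xy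

  interior : ∀ {u v P} → IsPath G u v P → u ≢ v → ∃[ I ] P ≡ route u I v
  interior {u} p u≢v with IsWalk.start (IsPath.walk p) | IsWalk.end (IsPath.walk p)
  ... | ys , refl | []     , P≡ = contradiction (∷-injectiveˡ P≡) u≢v
  ... | ys , refl | _ ∷ zs , P≡ = zs , cong (u ∷_) (∷-injectiveʳ P≡)

  spanning⇒theta : ∀ {u v I₁ I₂ I₃} → SpanningK23 G u v (route u I₁ v) (route u I₂ v) (route u I₃ v) →
                   Theta u v I₁ I₂ I₃
  spanning⇒theta S = record
    { path₁ = P₁ ; path₂ = P₂ ; path₃ = P₃
    ; disjoint₁₂ = λ (p , q) → disj₁₂ _ (∈⇒inner P₁ p) (∈⇒inner P₂ q)
    ; disjoint₁₃ = λ (p , q) → disj₁₃ _ (∈⇒inner P₁ p) (∈⇒inner P₃ q)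
    ; disjoint₂₃ = λ (p , q) → disj₂₃ _ (∈⇒inner P₂ p) (∈⇒inner P₃ q)
    }
    where
      open SpanningK23 S
      toPath : ∀ {u v I} → IsPath G u v (route u I v) → Path u v I
      toPath p = record { linked = IsWalk.linked (IsPath.walk p) ; unique = IsPath.unique p }
      P₁ = toPath path₁
      P₂ = toPath path₂
      P₃ = toPath path₃

  reverse-route : ∀ u I v → reverse (route u I v) ≡ route v (reverse I) u
  reverse-route u I v = trans (reverse-at (u ∷ I) v []) (cong (v ∷_) (unfold-reverse u I))

  ∈-reverse-route : ∀ {u I v z} → z ∈ route v (reverse I) u → z ∈ route u I v
  ∈-reverse-route {u} {I} {v} z∈ = Any.reverse⁻ (subst (_ ∈_) (sym (reverse-route u I v)) z∈)

  reverse-path : ∀ {u v I} → Path u v I → Path v u (reverse I)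
  reverse-path {u} {v} {I} P = record
    { linked = subst (Linked (Adj G)) (reverse-route u I v) (linked-reverse (Graph.sym G) (Path.linked P))
    ; unique = subst Unique (reverse-route u I v) (unique-reverse (Path.unique P))
    }

  reverse-disjoint : ∀ {I I′ : List Vertex} → Disjoint I I′ → Disjoint (reverse I) (reverse I′)
  reverse-disjoint I#I′ (p , q) = I#I′ (Any.reverse⁻ p , Any.reverse⁻ q)

  reverse-theta : ∀ {u v I₁ I₂ I₃} → Theta u v I₁ I₂ I₃ → Theta v u (reverse I₁) (reverse I₂) (reverse I₃)
  reverse-theta θ = record
    { path₁ = reverse-path path₁ ; path₂ = reverse-path path₂ ; path₃ = reverse-path path₃
    ; disjoint₁₂ = reverse-disjoint disjoint₁₂
    ; disjoint₁₃ = reverse-disjoint disjoint₁₃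
    ; disjoint₂₃ = reverse-disjoint disjoint₂₃
    }
    where open Theta θ

  route-split-start : ∀ u A (x : Vertex) B v → route u (A ++ x ∷ B) v ≡ route u A x ++ B ++ [ v ]
  route-split-start u A x B v =
    cong (u ∷_) (trans (++-assoc A (x ∷ B) [ v ]) (sym (++-assoc A [ x ] (B ++ [ v ]))))

  route-split-end : ∀ u A (x : Vertex) B v → route u (A ++ x ∷ B) v ≡ (u ∷ A) ++ route x B v
  route-split-end u A x B v = cong (u ∷_) (++-assoc A (x ∷ B) [ v ])

  reverse-path-at : ∀ {u v A x B} → Path u v (A ++ x ∷ B) → Path v u (reverse B ++ x ∷ reverse A)
  reverse-path-at {A = A} {x} {B} P = subst (Path _ _) (reverse-at A x B) (reverse-path P)

  ∈-reverse-at : ∀ {u v A x B z} → z ∈ route v (reverse B ++ x ∷ reverse A) u → z ∈ route u (A ++ x ∷ B) v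
  ∈-reverse-at {A = A} {x} {B} z∈ = ∈-reverse-route (subst (λ J → _ ∈ route _ J _) (sym (reverse-at A x B)) z∈)

  module _ {u v A x B} (P : Path u v (A ++ x ∷ B)) where

    prefix-linked : Linked (Adj G) (route u A x)
    prefix-linked = linked-++⁻ˡ (route u A x) (subst (Linked (Adj G)) (route-split-start u A x B v) (Path.linked P))

    prefix-unique : Unique (route u A x)
    prefix-unique = unique-++⁻ˡ (route u A x) (subst Unique (route-split-start u A x B v) (Path.unique P))

  prefix-⊆ : ∀ {u A x B v z} → z ∈ route u A x → z ∈ route u (A ++ x ∷ B) v
  prefix-⊆ {u} {A} {x} {B} {v} {z} z∈ = subst (z ∈_) (sym (route-split-start u A x B v)) (∈-++⁺ˡ z∈)

  interior-prefix-⊆ : ∀ A {x : Vertex} B → A ++ [ x ] ⊆ A ++ x ∷ B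
  interior-prefix-⊆ A {x} B = Subset.++⁺ʳ A (Subset.xs⊆xs++ys [ x ] B)

  ∉-route : ∀ {u A x z} → z ∉ u ∷ A → x ≢ z → z ∉ route u A x
  ∉-route {u} {A} z∉ x≢z z∈ with ∈-++⁻ (u ∷ A) z∈
  ... | inj₁ z∈A        = z∉ z∈A
  ... | inj₂ (here z≡x) = x≢z (sym z≡x)

  end-sides-avoid : ∀ {u v A x B C y D z} → Path u v (A ++ x ∷ B) → Path u v (C ++ y ∷ D) →
                    Disjoint (A ++ x ∷ B) (C ++ y ∷ D) → z ∈ u ∷ A → z ∉ route x B v × z ∉ route y D v
  end-sides-avoid {u} {v} {A} {x} {B} {C} {y} {D} P P′ I#I′ z∈ = own z∈ , other z∈
    where
      own : ∀ {z} → z ∈ u ∷ A → z ∉ route x B v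
      own z∈ z∈′ = unique-++⇒disjoint (u ∷ A) (subst Unique (route-split-end u A x B v) (Path.unique P)) (z∈ , z∈′)
      other : ∀ {z} → z ∈ u ∷ A → z ∉ route y D v
      other z∈ z∈′ with z∈ | ∈-++⁻ (y ∷ D) z∈′
      ... | here refl | inj₁ z∈I′        = start∉ P′ (∈-++⁺ʳ C z∈I′)
      ... | here refl | inj₂ (here refl) = start≢end P refl
      ... | there z∈A | inj₁ z∈I′        = I#I′ (∈-++⁺ˡ z∈A , ∈-++⁺ʳ C z∈I′)
      ... | there z∈A | inj₂ (here refl) = end∉ P (∈-++⁺ˡ z∈A)

  module Fan {X : Vertex → Set} {h : Vertex} {Q : List Vertex} (Q-unique : Unique Q)
             (fan : ∀ a b → X a → X b → Adj G a b → FanEdge h Q a b) where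
    open PathPositions _≟_ Q Q-unique using (Neighbours; rays-apart)

    Covers : List Vertex → Set
    Covers L = ∀ {z} → z ∈ L → X z

    neighbours-off-handle : ∀ {a b} → X a → X b → a ≢ h → b ≢ h → Adj G a b → Neighbours a b
    neighbours-off-handle Xa Xb a≢h b≢h ab with fan _ _ Xa Xb ab
    ... | inj₁ (a≡h , _)        = contradiction a≡h a≢h
    ... | inj₂ (inj₁ (b≡h , _)) = contradiction b≡h b≢h
    ... | inj₂ (inj₂ n)         = n

    linked-off-handle : ∀ {L} → Linked (Adj G) L → Covers L → h ∉ L → Linked Neighbours L
    linked-off-handle []       _  _  = []
    linked-off-handle [-]      _  _  = [-]
    linked-off-handle (r ∷ rs) XL h∉ =
      neighbours-off-handle (XL a∈) (XL b∈) (∈-∉⇒≢ a∈ h∉) (∈-∉⇒≢ b∈ h∉) r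
      ∷ linked-off-handle rs (XL ∘ there) (h∉ ∘ there)
      where
        a∈ = here refl
        b∈ = there (here refl)

    chord-near-start : ∀ {u v A x B C y D} →
      Path u v (A ++ x ∷ B) → Path u v (C ++ y ∷ D) → Disjoint (A ++ x ∷ B) (C ++ y ∷ D) →
      Covers (route u (A ++ x ∷ B) v) → Covers (route u (C ++ y ∷ D) v) →
      h ∉ route u A x → h ∉ route u C y → ¬ Adj G x y
    chord-near-start {A = A} {x} {B} {C} {y} {D} P P′ I#I′ XP XP′ h∉ h∉′ xy =
      rays-apart (linked-off-handle (prefix-linked P) (XP ∘ prefix-⊆) h∉) (prefix-unique P)
                 (linked-off-handle (prefix-linked P′) (XP′ ∘ prefix-⊆) h∉′) (prefix-unique P′)
                 (λ (p , q) → I#I′ (interior-prefix-⊆ A B p , interior-prefix-⊆ C D q)) x∈ y∈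
                 (neighbours-off-handle (XP (prefix-⊆ (there x∈))) (XP′ (prefix-⊆ (there y∈)))
                                        (∈-∉⇒≢ (there x∈) h∉) (∈-∉⇒≢ (there y∈) h∉′) xy)
      where
        x∈ = ∈-++⁺ʳ A (here refl)
        y∈ = ∈-++⁺ʳ C (here refl)

    chord-near-end : ∀ {u v A x B C y D} →
      Path u v (A ++ x ∷ B) → Path u v (C ++ y ∷ D) → Disjoint (A ++ x ∷ B) (C ++ y ∷ D) →
      Covers (route u (A ++ x ∷ B) v) → Covers (route u (C ++ y ∷ D) v) →
      h ∉ route x B v → h ∉ route y D v → ¬ Adj G x y
    chord-near-end {A = A} {x} {B} {C} {y} {D} P P′ I#I′ XP XP′ h∉ h∉′ =
      chord-near-start (reverse-path-at P) (reverse-path-at P′)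
        (subst₂ Disjoint (reverse-at A x B) (reverse-at C y D) (reverse-disjoint I#I′))
        (XP ∘ ∈-reverse-at) (XP′ ∘ ∈-reverse-at) (h∉ ∘ ∈-reverse-route) (h∉′ ∘ ∈-reverse-route)

    chord-off-handle : ∀ {u v I I′ x y} → Path u v I → Path u v I′ → Disjoint I I′ →
      Covers (route u I v) → Covers (route u I′ v) → x ∈ I → y ∈ I′ → x ≢ h → y ≢ h → ¬ Adj G x y
    chord-off-handle {u} P P′ I#I′ XP XP′ x∈ y∈ x≢h y≢h with ∈-∃++ x∈ | ∈-∃++ y∈
    ... | A , B , refl | C , D , refl with h ∈? u ∷ A | h ∈? u ∷ C
    ... | no h∉A  | no h∉C  = chord-near-start P P′ I#I′ XP XP′ (∉-route h∉A x≢h) (∉-route h∉C y≢h)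
    ... | yes h∈A | _       = uncurry (chord-near-end P P′ I#I′ XP XP′) (end-sides-avoid P P′ I#I′ h∈A)
    ... | no _    | yes h∈C =
      uncurry (flip (chord-near-end P P′ I#I′ XP XP′)) (end-sides-avoid P′ P (Disjoint.sym I#I′) h∈C)

    chord-through-handle : ∀ {u v I I′ x y} → Path u v I → Path u v I′ → Disjoint I I′ →
      Covers (route u I v) → Covers (route u I′ v) → x ∈ I → y ∈ I′ → Adj G x y → x ≡ h ⊎ y ≡ h
    chord-through-handle P P′ I#I′ XP XP′ x∈ y∈ xy with _ ≟ h | _ ≟ h
    ... | yes x≡h | _       = inj₁ x≡h
    ... | no _    | yes y≡h = inj₂ y≡h
    ... | no x≢h  | no y≢h  = contradiction xy (chord-off-handle P P′ I#I′ XP XP′ x∈ y∈ x≢h y≢h)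

  Step : List Vertex → Vertex → Vertex → Set
  Step L a b = Adj G a b × a ∈ L × b ∈ L

  star⇒walk : ∀ {L x y} → x ∈ L → Star (Step L) x y → ∃[ W ] (IsWalk G x y W × All (_∈ L) W)
  star⇒walk {x = x} x∈ ε = [ x ] , record { linked = [-] ; start = [] , refl ; end = [] , refl } , x∈ ∷ []
  star⇒walk {x = x} x∈ ((xz , _ , z∈) ◅ s) with star⇒walk z∈ s
  ... | W , w , W⊆ with IsWalk.start w | IsWalk.end w
  ... | _ , refl | zs , W≡ =
    x ∷ W , record { linked = xz ∷ IsWalk.linked w ; start = W , refl ; end = x ∷ zs , cong (x ∷_) W≡ } , x∈ ∷ W⊆

  from-head : ∀ {a L y} → Linked (Adj G) (a ∷ L) → y ∈ a ∷ L → Star (Step (a ∷ L)) a y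
  from-head _        (here refl) = ε
  from-head (r ∷ rs) (there y∈)  =
    (r , here refl , there (here refl)) ◅ Star.map (λ (s , p , q) → s , there p , there q) (from-head rs y∈)

  walk-within : ∀ {L x y} → Linked (Adj G) L → x ∈ L → y ∈ L → ∃[ W ] (IsWalk G x y W × All (_∈ L) W)
  walk-within {_ ∷ _} rs x∈ y∈ =
    star⇒walk x∈ (Star.reverse (λ (s , p , q) → Graph.sym G s , q , p) (from-head rs x∈) ◅◅ from-head rs y∈)

  touch-sym : ∀ {L L′} → Touch L L′ → Touch L′ L
  touch-sym (x , y , x∈ , y∈ , xy) = y , x , y∈ , x∈ , Graph.sym G xy

  minor-from-paths : (H : Graph) (B : V H → List Vertex) →
                     (∀ a → ∃[ x ] x ∈ B a) → (∀ a → Linked (Adj G) (B a)) →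
                     AllPairs Disjoint (tabulate B) → (∀ a b → Adj H a b → Touch (B a) (B b)) →
                     IsMinor H G
  minor-from-paths H B nonempty linked pairwise touch = record
    { branch    = λ a x → x ∈ B a
    ; nonempty  = nonempty
    ; disjoint  = λ _ _ _ → disjoint-family pairwise
    ; connected = λ a _ _ → walk-within (linked a)
    ; edges     = touch
    }

  -- A branch set for a degree-2 vertex of K₂,₃, whose degree-3 vertices have branch sets {t} and {h};
  -- {w} is the branch set of the isolated vertex.
  record Lobe (t h w : Vertex) (M : List Vertex) : Set where
    field
      linked      : Linked (Adj G) M
      t-neighbour : Touch [ t ] M
      h-neighbour : Touch [ h ] M
      t∉          : t ∉ M
      h∉          : h ∉ M
      w∉          : w ∉ M

  K1∪K23-minor : ∀ {t h w M₁ M₂ M₃} → t ≢ h → t ≢ w → h ≢ w →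
                 Lobe t h w M₁ → Lobe t h w M₂ → Lobe t h w M₃ →
                 Disjoint M₁ M₂ → Disjoint M₁ M₃ → Disjoint M₂ M₃ → IsMinor K1∪K23 G
  K1∪K23-minor {t} {h} {w} {M₁} {M₂} {M₃} t≢h t≢w h≢w L₁ L₂ L₃ d₁₂ d₁₃ d₂₃ =
    minor-from-paths K1∪K23 B nonempty linked pairwise touch
    where
      open Lobe using (t-neighbour; h-neighbour; t∉; h∉; w∉)
      B : Fin 6 → List Vertex
      B 0F = [ t ]
      B 1F = [ h ]
      B 2F = M₁
      B 3F = M₂
      B 4F = M₃
      B 5F = [ w ]

      lobe-∈ : ∀ {M} → Lobe t h w M → ∃[ x ] x ∈ M
      lobe-∈ L = let _ , m , _ , m∈ , _ = t-neighbour L in m , m∈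

      nonempty : ∀ a → ∃[ x ] x ∈ B a
      nonempty 0F = t , here refl
      nonempty 1F = h , here refl
      nonempty 2F = lobe-∈ L₁
      nonempty 3F = lobe-∈ L₂
      nonempty 4F = lobe-∈ L₃
      nonempty 5F = w , here refl

      linked : ∀ a → Linked (Adj G) (B a)
      linked 0F = [-]
      linked 1F = [-]
      linked 2F = Lobe.linked L₁
      linked 3F = Lobe.linked L₂
      linked 4F = Lobe.linked L₃
      linked 5F = [-]

      pairwise : AllPairs Disjoint (tabulate B)
      pairwise =
        (≢⇒disjoint t≢h ∷ ∉⇒disjoint (t∉ L₁) ∷ ∉⇒disjoint (t∉ L₂) ∷ ∉⇒disjoint (t∉ L₃) ∷ ≢⇒disjoint t≢w ∷ []) ∷
        (∉⇒disjoint (h∉ L₁) ∷ ∉⇒disjoint (h∉ L₂) ∷ ∉⇒disjoint (h∉ L₃) ∷ ≢⇒disjoint h≢w ∷ []) ∷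
        (d₁₂ ∷ d₁₃ ∷ Disjoint.sym (∉⇒disjoint (w∉ L₁)) ∷ []) ∷
        (d₂₃ ∷ Disjoint.sym (∉⇒disjoint (w∉ L₂)) ∷ []) ∷
        (Disjoint.sym (∉⇒disjoint (w∉ L₃)) ∷ []) ∷
        [] ∷ []

      touch : ∀ a b → T (k123 a b) → Touch (B a) (B b)
      touch 0F 2F _ = t-neighbour L₁
      touch 0F 3F _ = t-neighbour L₂
      touch 0F 4F _ = t-neighbour L₃
      touch 1F 2F _ = h-neighbour L₁
      touch 1F 3F _ = h-neighbour L₂
      touch 1F 4F _ = h-neighbour L₃
      touch 2F 0F _ = touch-sym (t-neighbour L₁)
      touch 3F 0F _ = touch-sym (t-neighbour L₂)
      touch 4F 0F _ = touch-sym (t-neighbour L₃)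
      touch 2F 1F _ = touch-sym (h-neighbour L₁)
      touch 3F 1F _ = touch-sym (h-neighbour L₂)
      touch 4F 1F _ = touch-sym (h-neighbour L₃)
      touch 0F 0F ()
      touch 0F 1F ()
      touch 0F 5F ()
      touch 1F 0F ()
      touch 1F 1F ()
      touch 1F 5F ()
      touch 2F 2F ()
      touch 2F 3F ()
      touch 2F 4F ()
      touch 2F 5F ()
      touch 3F 2F ()
      touch 3F 3F ()
      touch 3F 4F ()
      touch 3F 5F ()
      touch 4F 2F ()
      touch 4F 3F ()
      touch 4F 4F ()
      touch 4F 5F ()
      touch 5F _  ()

  lobe-before-handle : ∀ {u v S h S′ s} → Path u v (S ++ h ∷ S′) → s ∈ S → Lobe u h v S
  lobe-before-handle {u} {v} {S} {h} {S′} P s∈ = record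
    { linked      = Linked.tail (linked-++⁻ˡ (u ∷ S) L)
    ; t-neighbour = let m , m∈ , um = linked-first s∈ (linked-++⁻ˡ (u ∷ S) L) in u , m , here refl , m∈ , um
    ; h-neighbour = let m , m∈ , mh = linked-last S s∈ (Linked.tail L) in h , m , here refl , m∈ , Graph.sym G mh
    ; t∉          = start∉ P ∘ ∈-++⁺ˡ
    ; h∉          = λ h∈ → unique-++⇒disjoint (u ∷ S) U (there h∈ , here refl)
    ; w∉          = end∉ P ∘ ∈-++⁺ˡ
    }
    where
      L = subst (Linked (Adj G)) (route-split-end u S h S′ v) (Path.linked P)
      U = subst Unique (route-split-end u S h S′ v) (Path.unique P)

  lobe-interior : ∀ {u v I h y} → Path u v I → y ∈ I → Adj G h y → h ∉ I → Lobe u h v I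
  lobe-interior P y∈ hy h∉ = record
    { linked      = interior-linked P
    ; t-neighbour = first-step P y∈
    ; h-neighbour = _ , _ , here refl , y∈ , hy
    ; t∉          = start∉ P
    ; h∉          = h∉
    ; w∉          = end∉ P
    }

  vertex-before-handle⇒K1∪K23 : ∀ {u v I₁ S h S′ I₃ s y₁ y₃} → Theta u v I₁ (S ++ h ∷ S′) I₃ → s ∈ S →
                       y₁ ∈ I₁ → Adj G h y₁ → y₃ ∈ I₃ → Adj G h y₃ → IsMinor K1∪K23 G
  vertex-before-handle⇒K1∪K23 {S = S} θ s∈ y₁∈ hy₁ y₃∈ hy₃ =
    K1∪K23-minor (≢-sym (∈-∉⇒≢ h∈ (start∉ path₂))) (start≢end path₁) (∈-∉⇒≢ h∈ (end∉ path₂))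
                 (lobe-before-handle path₂ s∈)
                 (lobe-interior path₁ y₁∈ hy₁ (λ h∈₁ → disjoint₁₂ (h∈₁ , h∈)))
                 (lobe-interior path₃ y₃∈ hy₃ (λ h∈₃ → disjoint₂₃ (h∈ , h∈₃)))
                 (λ (p , q) → disjoint₁₂ (q , ∈-++⁺ˡ p)) (λ (p , q) → disjoint₂₃ (∈-++⁺ˡ p , q)) disjoint₁₃
    where
      open Theta θ
      h∈ = ∈-++⁺ʳ S (here refl)

  interior-singleton : ∀ {u v I₁ I₂ I₃ h y₁ y₃} → ¬ IsMinor K1∪K23 G → Theta u v I₁ I₂ I₃ →
                  h ∈ I₂ → y₁ ∈ I₁ → Adj G h y₁ → y₃ ∈ I₃ → Adj G h y₃ → I₂ ≡ [ h ]
  interior-singleton no-minor θ h∈ y₁∈ hy₁ y₃∈ hy₃ with ∈-∃++ h∈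
  ... | []    , []     , refl = refl
  ... | _ ∷ _ , _      , refl = contradiction (vertex-before-handle⇒K1∪K23 θ (here refl) y₁∈ hy₁ y₃∈ hy₃) no-minor
  ... | []    , s ∷ S′ , refl =
    contradiction (vertex-before-handle⇒K1∪K23 θ′ (Any.reverse⁺ {xs = s ∷ S′} (here refl))
                                               (Any.reverse⁺ y₁∈) hy₁ (Any.reverse⁺ y₃∈) hy₃)
                  no-minor
    where θ′ = subst (λ J → Theta _ _ _ J _) (reverse-at [] _ (s ∷ S′)) (reverse-theta θ)

  module _ {u v I₁ I₂ I₃} (θ : Theta u v I₁ I₂ I₃) where
    open Theta θ

    handle-in-middle : ∀ {h x y x′ y′} → x ∈ I₂ → y ∈ I₁ → x ≡ h ⊎ y ≡ h →
                       x′ ∈ I₂ → y′ ∈ I₃ → x′ ≡ h ⊎ y′ ≡ h → x ≡ h × x′ ≡ h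
    handle-in-middle x∈ y∈ (inj₁ x≡h)  x′∈ y′∈ (inj₁ x′≡h) = x≡h , x′≡h
    handle-in-middle x∈ y∈ (inj₁ refl) x′∈ y′∈ (inj₂ refl) = ⊥-elim (disjoint₂₃ (x∈ , y′∈))
    handle-in-middle x∈ y∈ (inj₂ refl) x′∈ y′∈ (inj₁ refl) = ⊥-elim (disjoint₁₂ (y∈ , x′∈))
    handle-in-middle x∈ y∈ (inj₂ refl) x′∈ y′∈ (inj₂ refl) = ⊥-elim (disjoint₁₃ (y∈ , y′∈))

    middle-is-handle : ∀ {h} → ¬ IsMinor K1∪K23 G →
      EdgeBetweenInner G u v (route u I₂ v) (route u I₁ v) → EdgeBetweenInner G u v (route u I₂ v) (route u I₃ v) →
      InFanWithHandle G (λ z → z ∈ route u I₁ v ⊎ z ∈ route u I₂ v) h →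
      InFanWithHandle G (λ z → z ∈ route u I₂ v ⊎ z ∈ route u I₃ v) h →
      I₂ ≡ [ h ]
    middle-is-handle no-minor e₂₁ e₂₃ (_ , _ , Q-unique , _ , _ , fan₁₂) (_ , _ , Q′-unique , _ , _ , fan₂₃)
      with inner-edge⇒touch e₂₁ | inner-edge⇒touch e₂₃
    ... | x , y , x∈ , y∈ , xy | x′ , y′ , x′∈ , y′∈ , x′y′
      with handle-in-middle
             x∈  y∈  (Fan.chord-through-handle Q-unique fan₁₂ path₂ path₁ (Disjoint.sym disjoint₁₂)
                                               inj₂ inj₁ x∈ y∈ xy)
             x′∈ y′∈ (Fan.chord-through-handle Q′-unique fan₂₃ path₂ path₃ disjoint₂₃
                                               inj₁ inj₂ x′∈ y′∈ x′y′)
    ... | refl , refl = interior-singleton no-minor θ x∈ y∈ xy y′∈ x′y′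

lemma9 : (G : Graph) → ¬ IsMinor K113 G → ¬ IsMinor K1∪K23 G →
         (u v : V G) (P₁ P₂ P₃ : List (V G)) →
         SpanningK23 G u v P₁ P₂ P₃ →
         EdgeBetweenInner G u v P₂ P₁ → EdgeBetweenInner G u v P₂ P₃ →
         (h : V G) →
         InFanWithHandle G (λ x → x ∈ P₁ ⊎ x ∈ P₂) h →
         InFanWithHandle G (λ x → x ∈ P₂ ⊎ x ∈ P₃) h →
         length P₂ ≡ 3
lemma9 G _ no-minor u v P₁ P₂ P₃ S e₂₁ e₂₃ h fan₁₂ fan₂₃
  with interior G (SpanningK23.path₁ S) (SpanningK23.u≢v S)
     | interior G (SpanningK23.path₂ S) (SpanningK23.u≢v S)
     | interior G (SpanningK23.path₃ S) (SpanningK23.u≢v S)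
... | I₁ , refl | I₂ , refl | I₃ , refl =
  cong (λ I → length (route G u I v)) (middle-is-handle G (spanning⇒theta G S) no-minor e₂₁ e₂₃ fan₁₂ fan₂₃)
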